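{- There is an absolute constant $c>0$ such that for every integer $n\geq 6$ there exists a red/blue coloring $\phi$ of the unordered pairs of $U=\{0,1,\dots,\lfloor 2^{cn}\rfloor\}$ with both of the following properties: \begin{enumerate} \item There are no three pairwise disjoint $n$-element sets $A,B,C\subset U$ together with a bijection $f:B\to C$ such that for every $a\in A$ and $b\in B$, at least one of $\phi(a,b)=\text{red}$ or $\phi(a,f(b))=\text{blue}$ holds. \item There is no $n$-element set $A\subset U$ such that every $4$-tuple $a_i<a_j<a_k<a_\ell$ of elements of $A$ avoids the pattern \[\phi(a_i,a_j)=\phi(a_j,a_k)=\phi(a_j,a_\ell)=\text{red},\qquad \phi(a_i,a_k)=\phi(a_i,a_\ell)=\phi(a_k,a_\ell)=\text{blue}.\] \end{enumerate} -}

module Defs where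

open import Data.Nat using (ℕ; suc; _≤_; _<_; _^_; _*_)
open import Data.Fin using (Fin) renaming (_<_ to _<ᶠ_)
open import Data.Bool using (Bool; true; false)
open import Data.Product using (Σ; ∃; _×_)
open import Data.Sum using (_⊎_)
open import Relation.Binary.PropositionalEquality using (_≡_; _≢_)
open import Relation.Nullary using (¬_)
open import Function.Definitions using (Injective)

Color : Set
Color = Bool

red blue : Color
red  = true
blue = false

-- The ground set U = {0,1,...,N} is Fin (suc N).
-- A red/blue colouring of the unordered pairs of Fin m: a symmetric
-- function (values on the diagonal are irrelevant).
Coloring : ℕ → Set
Coloring m = Σ (Fin m → Fin m → Color) λ φ → ∀ x y → φ x y ≡ φ y x

-- N = ⌊ 2 ^ (p n / q) ⌋  (q > 0), characterised exactly:
-- N ^ q ≤ 2 ^ (p * n) < (N + 1) ^ q.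
IsFloorPow2 : (p q n N : ℕ) → Set
IsFloorPow2 p q n N = (N ^ q ≤ 2 ^ (p * n)) × (2 ^ (p * n) < suc N ^ q)

-- A, B are given by injective enumerations a, b : Fin n → U, and C by
-- c = f ∘ b (so c is injective; any bijection f arises this way).
BadTriple : (m n : ℕ) → (Fin m → Fin m → Color) → Set
BadTriple m n φ =
  Σ (Fin n → Fin m) λ a → Σ (Fin n → Fin m) λ b → Σ (Fin n → Fin m) λ c →
    Injective _≡_ _≡_ a × Injective _≡_ _≡_ b × Injective _≡_ _≡_ c ×
    (∀ i j → a i ≢ b j) × (∀ i j → a i ≢ c j) × (∀ i j → b i ≢ c j) ×
    (∀ i j → (φ (a i) (b j) ≡ red) ⊎ (φ (a i) (c j) ≡ blue))

Pattern : {m : ℕ} → (Fin m → Fin m → Color) → Fin m → Fin m → Fin m → Fin m → Set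
Pattern φ x y z w =
  (φ x y ≡ red) × (φ y z ≡ red) × (φ y w ≡ red) ×
  (φ x z ≡ blue) × (φ x w ≡ blue) × (φ z w ≡ blue)

BadSet : (m n : ℕ) → (Fin m → Fin m → Color) → Set
BadSet m n φ =
  Σ (Fin n → Fin m) λ a →
    (∀ i j → i <ᶠ j → a i <ᶠ a j) ×
    (∀ i j k l → i <ᶠ j → j <ᶠ k → k <ᶠ l → ¬ Pattern φ (a i) (a j) (a k) (a l))

-- The probabilistic method, as counting over colourings of the pairs of U = Fin M, M = N + 1.
-- For disjoint injective a, b, c the 2n² pairs {a i, b j}, {a i, c j} are distinct, so only a
-- (3/4)^(n²) fraction of colourings avoids "blue, red" on every (i , j); summed over the M^(3n)
-- choices of a, b, c this is less than 1/2.  Inside any increasing a we fix m² 4-tuples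
-- (m = n / 16), no two sharing two points, so their six pairs are distinct and at most a
-- (63/64)^(m²) fraction of colourings avoids the pattern on all of them; summed over the M^n
-- choices of a this is again less than 1/2.  Both estimates hold once N ^ q ≤ 2 ^ n with
-- q = 110000, so some colouring has neither structure.  When M < n there is no injective a at all.
module Submission where

open import Defs
open import Data.Nat using (ℕ; zero; suc; _+_; _*_; _^_; _≤_; _<_; z≤n; s≤s; z<s; s<s; NonZero; >-nonZero)
open import Data.Nat.Properties
open import Data.Nat.Tactic.RingSolver using (solve-∀)
open import Data.Nat.DivMod using (_/_; _%_; m/n*n≤m; m≡m%n+[m/n]*n; m%n<n; /-monoˡ-≤)
open import Data.Fin using (Fin; zero; suc; toℕ; fromℕ<; inject≤; combine; remQuot) renaming (_<_ to _<ᶠ_)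
open import Data.Fin.Patterns using (0F; 1F; 2F; 3F; 4F; 5F)
import Data.Fin.Properties as Fin
open import Data.Vec using (Vec; []; _∷_; lookup; tabulate; replicate; _[_]≔_)
open import Data.Vec.Properties
  using (≡-dec; tabulate-cong; tabulate∘lookup; lookup∘tabulate; lookup∘updateAt; lookup∘updateAt′)
import Data.Product.Properties as Product
open import Data.Sum using (_⊎_; inj₁; inj₂; [_,_])
open import Data.Product using (Σ; ∃; _×_; _,_; proj₁; proj₂)
open import Function using (_∘_; _$_)
open import Function.Definitions using (Injective)
open import Relation.Binary.PropositionalEquality hiding ([_])
open import Relation.Binary.Definitions using (tri<; tri≈; tri>)
open import Relation.Nullary using (¬_; Dec; yes; no; contradiction)
open import Relation.Nullary.Decidable using (_→-dec_; _×-dec_; toWitness)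
open import Algebra.Properties.CommutativeSemigroup *-commutativeSemigroup
  using (x∙yz≈y∙xz; x∙yz≈y∙zx; xy∙z≈y∙xz)
open import Algebra.Properties.Semiring.Sum +-*-semiring
  using (sum-syntax; sum-cong-≗; ∑-comm; ∑-distrib-+; *-distribˡ-sum; sum-remove)

∑-const : ∀ D c → ∑[ x < D ] c ≡ D * c
∑-const zero    c = refl
∑-const (suc D) c = cong (c +_) (∑-const D c)

∑-mono : ∀ {D} {f g : Fin D → ℕ} → (∀ x → f x ≤ g x) → ∑[ x < D ] f x ≤ ∑[ x < D ] g x
∑-mono {zero}  f≤g = z≤n
∑-mono {suc D} f≤g = +-mono-≤ (f≤g zero) (∑-mono (f≤g ∘ suc))

∑≡0⇒≡0 : ∀ {D} (f : Fin D → ℕ) → ∑[ x < D ] f x ≡ 0 → ∀ x → f x ≡ 0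
∑≡0⇒≡0 {suc D} f ∑≡0 x = m+n≡0⇒m≡0 (f x) (trans (sym (sum-remove {i = x} f)) ∑≡0)

∑<⇒∃< : ∀ {D} (f : Fin D → ℕ) c → ∑[ x < D ] f x < D * c → ∃ λ x → f x < c
∑<⇒∃< {D} f c ∑<Dc with Fin.any? (λ x → f x <? c)
... | yes found = found
... | no  none  = contradiction (≤-trans (≤-reflexive (sym (∑-const D c))) (∑-mono c≤f)) (<⇒≱ ∑<Dc)
  where
  c≤f : ∀ x → c ≤ f x
  c≤f x = ≮⇒≥ (λ fx<c → none (x , fx<c))

∑ᵛ : ∀ {D} K → (Vec (Fin D) K → ℕ) → ℕ
∑ᵛ zero        F = F []
∑ᵛ {D} (suc K) F = ∑[ x < D ] ∑ᵛ K (λ v → F (x ∷ v))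

module _ {D : ℕ} where

  ∑ᵛ-cong : ∀ K {F G : Vec (Fin D) K → ℕ} → (∀ v → F v ≡ G v) → ∑ᵛ K F ≡ ∑ᵛ K G
  ∑ᵛ-cong zero    F≗G = F≗G []
  ∑ᵛ-cong (suc K) F≗G = sum-cong-≗ (λ x → ∑ᵛ-cong K (F≗G ∘ (x ∷_)))

  ∑ᵛ-mono : ∀ K {F G : Vec (Fin D) K → ℕ} → (∀ v → F v ≤ G v) → ∑ᵛ K F ≤ ∑ᵛ K G
  ∑ᵛ-mono zero    F≤G = F≤G []
  ∑ᵛ-mono (suc K) F≤G = ∑-mono (λ x → ∑ᵛ-mono K (F≤G ∘ (x ∷_)))

  ∑ᵛ-const : ∀ K c → ∑ᵛ {D} K (λ _ → c) ≡ D ^ K * c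
  ∑ᵛ-const zero    c = sym (+-identityʳ c)
  ∑ᵛ-const (suc K) c = begin
    ∑[ x < D ] (∑ᵛ {D} K (λ _ → c))  ≡⟨ sum-cong-≗ {D} (λ _ → ∑ᵛ-const K c) ⟩
    ∑[ x < D ] (D ^ K * c)           ≡⟨ ∑-const D (D ^ K * c) ⟩
    D * (D ^ K * c)                  ≡⟨ *-assoc D (D ^ K) c ⟨
    D * D ^ K * c                    ∎
    where open ≡-Reasoning

  ∑ᵛ-distrib-+ : ∀ K (F G : Vec (Fin D) K → ℕ) → ∑ᵛ K (λ v → F v + G v) ≡ ∑ᵛ K F + ∑ᵛ K G
  ∑ᵛ-distrib-+ zero    F G = refl
  ∑ᵛ-distrib-+ (suc K) F G =
    trans (sum-cong-≗ (λ x → ∑ᵛ-distrib-+ K (F ∘ (x ∷_)) (G ∘ (x ∷_))))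
          (∑-distrib-+ (λ x → ∑ᵛ K (F ∘ (x ∷_))) (λ x → ∑ᵛ K (G ∘ (x ∷_))))

  *-distribˡ-∑ᵛ : ∀ K c (F : Vec (Fin D) K → ℕ) → c * ∑ᵛ K F ≡ ∑ᵛ K (λ v → c * F v)
  *-distribˡ-∑ᵛ zero    c F = refl
  *-distribˡ-∑ᵛ (suc K) c F =
    trans (*-distribˡ-sum c (λ x → ∑ᵛ K (F ∘ (x ∷_))))
          (sum-cong-≗ (λ x → *-distribˡ-∑ᵛ K c (F ∘ (x ∷_))))

  *-distribʳ-∑ᵛ : ∀ K c (F : Vec (Fin D) K → ℕ) → ∑ᵛ K F * c ≡ ∑ᵛ K (λ v → F v * c)
  *-distribʳ-∑ᵛ K c F = begin
    ∑ᵛ K F * c                 ≡⟨ *-comm (∑ᵛ K F) c ⟩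
    c * ∑ᵛ K F                 ≡⟨ *-distribˡ-∑ᵛ K c F ⟩
    ∑ᵛ K (λ v → c * F v)       ≡⟨ ∑ᵛ-cong K (λ v → *-comm c (F v)) ⟩
    ∑ᵛ K (λ v → F v * c)       ∎
    where open ≡-Reasoning

  ∑ᵛ-∑-comm : ∀ K {E} (F : Vec (Fin D) K → Fin E → ℕ) →
              ∑ᵛ K (λ v → ∑[ y < E ] F v y) ≡ ∑[ y < E ] ∑ᵛ K (λ v → F v y)
  ∑ᵛ-∑-comm zero    F = refl
  ∑ᵛ-∑-comm (suc K) F =
    trans (sum-cong-≗ (λ x → ∑ᵛ-∑-comm K (F ∘ (x ∷_))))
          (∑-comm (λ x y → ∑ᵛ K (λ v → F (x ∷ v) y)))

  ∑ᵛ-comm : ∀ K {D′} K′ (F : Vec (Fin D) K → Vec (Fin D′) K′ → ℕ) →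
            ∑ᵛ K (λ v → ∑ᵛ K′ (F v)) ≡ ∑ᵛ K′ (λ w → ∑ᵛ K (λ v → F v w))
  ∑ᵛ-comm K zero     F = refl
  ∑ᵛ-comm K (suc K′) F =
    trans (∑ᵛ-∑-comm K (λ v x → ∑ᵛ K′ (F v ∘ (x ∷_))))
          (sum-cong-≗ (λ x → ∑ᵛ-comm K K′ (λ v → F v ∘ (x ∷_))))

  ∑ᵛ≡0⇒≡0 : ∀ K (F : Vec (Fin D) K → ℕ) → ∑ᵛ K F ≡ 0 → ∀ v → F v ≡ 0
  ∑ᵛ≡0⇒≡0 zero    F ∑≡0 []      = ∑≡0
  ∑ᵛ≡0⇒≡0 (suc K) F ∑≡0 (x ∷ v) = ∑ᵛ≡0⇒≡0 K (F ∘ (x ∷_)) (∑≡0⇒≡0 _ ∑≡0 x) v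

  ∑ᵛ<⇒∃≡0 : ∀ K (F : Vec (Fin D) K → ℕ) → ∑ᵛ K F < D ^ K → ∃ λ v → F v ≡ 0
  ∑ᵛ<⇒∃≡0 zero    F ∑<1 = [] , n<1⇒n≡0 ∑<1
  ∑ᵛ<⇒∃≡0 (suc K) F ∑<  with ∑<⇒∃< _ (D ^ K) ∑<
  ... | x , ∑<′ with ∑ᵛ<⇒∃≡0 K (F ∘ (x ∷_)) ∑<′
  ...   | v , Fv≡0 = x ∷ v , Fv≡0

∏ : ∀ {L} → (Fin L → ℕ) → ℕ
∏ {zero}  f = 1
∏ {suc L} f = f zero * ∏ (f ∘ suc)

∏-cong : ∀ {L} {f g : Fin L → ℕ} → (∀ ℓ → f ℓ ≡ g ℓ) → ∏ f ≡ ∏ g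
∏-cong {zero}  f≗g = refl
∏-cong {suc L} f≗g = cong₂ _*_ (f≗g zero) (∏-cong (f≗g ∘ suc))

∏-ones : ∀ {L} (f : Fin L → ℕ) → (∀ ℓ → f ℓ ≡ 1) → ∏ f ≡ 1
∏-ones {zero}  f f≡1 = refl
∏-ones {suc L} f f≡1 = cong₂ _*_ (f≡1 zero) (∏-ones (f ∘ suc) (f≡1 ∘ suc))

module _ {A : Set} where

  select : ∀ {K r} → (Fin r → Fin K) → Vec A K → Vec A r
  select ps h = tabulate (lookup h ∘ ps)

  overwrite : ∀ {K r} → (Fin r → Fin K) → Vec A r → Vec A K → Vec A K
  overwrite ps []      h = h
  overwrite ps (x ∷ v) h = overwrite (ps ∘ suc) v (h [ ps zero ]≔ x)

  lookup-overwrite-outside : ∀ {K r} (ps : Fin r → Fin K) v h {k} → (∀ s → ps s ≢ k) →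
                             lookup (overwrite ps v h) k ≡ lookup h k
  lookup-overwrite-outside ps []      h k∉ps = refl
  lookup-overwrite-outside ps (x ∷ v) h k∉ps =
    trans (lookup-overwrite-outside (ps ∘ suc) v _ (k∉ps ∘ suc))
          (lookup∘updateAt′ _ (ps zero) (k∉ps zero ∘ sym) h)

  lookup-overwrite : ∀ {K r} (ps : Fin r → Fin K) → Injective _≡_ _≡_ ps →
                     ∀ v h s → lookup (overwrite ps v h) (ps s) ≡ lookup v s
  lookup-overwrite ps ps-inj (x ∷ v) h zero =
    trans (lookup-overwrite-outside (ps ∘ suc) v _ (λ s e → Fin.0≢1+n (ps-inj (sym e))))
          (lookup∘updateAt (ps zero) h)
  lookup-overwrite ps ps-inj (x ∷ v) h (suc s) =
    lookup-overwrite (ps ∘ suc) (Fin.suc-injective ∘ ps-inj) v _ s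

  select-overwrite : ∀ {K r} (ps : Fin r → Fin K) → Injective _≡_ _≡_ ps →
                     ∀ v h → select ps (overwrite ps v h) ≡ v
  select-overwrite ps ps-inj v h =
    trans (tabulate-cong (lookup-overwrite ps ps-inj v h)) (tabulate∘lookup v)

  select-overwrite-outside : ∀ {K r r′} (qs : Fin r′ → Fin K) (ps : Fin r → Fin K) →
                             (∀ s′ s → qs s′ ≢ ps s) → ∀ v h → select qs (overwrite ps v h) ≡ select qs h
  select-overwrite-outside qs ps qs∉ps v h =
    tabulate-cong (λ s′ → lookup-overwrite-outside ps v h (λ s e → qs∉ps s′ s (sym e)))

lookup-select : ∀ {A : Set} {K r} (ps : Fin r → Fin K) (h : Vec A K) {v} →
                select ps h ≡ v → ∀ s → lookup h (ps s) ≡ lookup v s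
lookup-select ps h e s = trans (sym (lookup∘tabulate (lookup h ∘ ps) s)) (cong (λ v → lookup v s) e)

module _ {D : ℕ} where

  ∑ᵛ-[]≔ : ∀ K (k : Fin K) (F : Vec (Fin D) K → ℕ) →
                D * ∑ᵛ K F ≡ ∑[ x < D ] ∑ᵛ K (λ h → F (h [ k ]≔ x))
  ∑ᵛ-[]≔ (suc K) zero    F = begin
    D * ∑[ y < D ] T y                   ≡⟨ *-distribˡ-sum D T ⟩
    ∑[ y < D ] (D * T y)                 ≡⟨ sum-cong-≗ {D} (λ y → ∑-const D (T y)) ⟨
    ∑[ y < D ] ∑[ x < D ] T y            ∎
    where
    open ≡-Reasoning
    T : Fin D → ℕ
    T y = ∑ᵛ K (λ h → F (y ∷ h))
  ∑ᵛ-[]≔ (suc K) (suc k) F = begin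
    D * ∑[ y < D ] ∑ᵛ K (λ h → F (y ∷ h))
      ≡⟨ *-distribˡ-sum D (λ y → ∑ᵛ K (λ h → F (y ∷ h))) ⟩
    ∑[ y < D ] (D * ∑ᵛ K (λ h → F (y ∷ h)))
      ≡⟨ sum-cong-≗ {D} (λ y → ∑ᵛ-[]≔ K k (F ∘ (y ∷_))) ⟩
    ∑[ y < D ] ∑[ x < D ] ∑ᵛ K (λ h → F (y ∷ (h [ k ]≔ x)))
      ≡⟨ ∑-comm (λ y x → ∑ᵛ K (λ h → F (y ∷ (h [ k ]≔ x)))) ⟩
    ∑[ x < D ] ∑[ y < D ] ∑ᵛ K (λ h → F (y ∷ (h [ k ]≔ x)))
      ∎
    where open ≡-Reasoning

  ∑ᵛ-overwrite : ∀ K r (ps : Fin r → Fin K) (F : Vec (Fin D) K → ℕ) →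
                 D ^ r * ∑ᵛ K F ≡ ∑ᵛ r (λ v → ∑ᵛ K (λ h → F (overwrite ps v h)))
  ∑ᵛ-overwrite K zero    ps F = *-identityˡ (∑ᵛ K F)
  ∑ᵛ-overwrite K (suc r) ps F = begin
    D * D ^ r * ∑ᵛ K F
      ≡⟨ *-assoc D (D ^ r) _ ⟩
    D * (D ^ r * ∑ᵛ K F)
      ≡⟨ cong (D *_) (∑ᵛ-overwrite K r (ps ∘ suc) F) ⟩
    D * ∑ᵛ r (λ v → ∑ᵛ K (F ∘ overwrite (ps ∘ suc) v))
      ≡⟨ *-distribˡ-∑ᵛ r D _ ⟩
    ∑ᵛ r (λ v → D * ∑ᵛ K (F ∘ overwrite (ps ∘ suc) v))
      ≡⟨ ∑ᵛ-cong r (λ v → ∑ᵛ-[]≔ K (ps zero) (F ∘ overwrite (ps ∘ suc) v)) ⟩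
    ∑ᵛ r (λ v → ∑[ x < D ] ∑ᵛ K (λ h → F (overwrite ps (x ∷ v) h)))
      ≡⟨ ∑ᵛ-∑-comm r (λ v x → ∑ᵛ K (λ h → F (overwrite ps (x ∷ v) h))) ⟩
    ∑[ x < D ] ∑ᵛ r (λ v → ∑ᵛ K (λ h → F (overwrite ps (x ∷ v) h)))
      ∎
    where open ≡-Reasoning

  ∑ᵛ-factor : ∀ K r (ps : Fin r → Fin K) → Injective _≡_ _≡_ ps →
              (g : Vec (Fin D) r → ℕ) (G : Vec (Fin D) K → ℕ) → (∀ v h → G (overwrite ps v h) ≡ G h) →
              D ^ r * ∑ᵛ K (λ h → g (select ps h) * G h) ≡ ∑ᵛ r g * ∑ᵛ K G
  ∑ᵛ-factor K r ps ps-inj g G G-ignores-ps = begin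
    D ^ r * ∑ᵛ K (λ h → g (select ps h) * G h)
      ≡⟨ ∑ᵛ-overwrite K r ps _ ⟩
    ∑ᵛ r (λ v → ∑ᵛ K (λ h → g (select ps (overwrite ps v h)) * G (overwrite ps v h)))
      ≡⟨ ∑ᵛ-cong r (λ v → ∑ᵛ-cong K (λ h →
           cong₂ _*_ (cong g (select-overwrite ps ps-inj v h)) (G-ignores-ps v h))) ⟩
    ∑ᵛ r (λ v → ∑ᵛ K (λ h → g v * G h))
      ≡⟨ ∑ᵛ-cong r (λ v → *-distribˡ-∑ᵛ K (g v) G) ⟨
    ∑ᵛ r (λ v → g v * ∑ᵛ K G)
      ≡⟨ *-distribʳ-∑ᵛ r (∑ᵛ K G) g ⟨
    ∑ᵛ r g * ∑ᵛ K G
      ∎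
    where open ≡-Reasoning

BlocksInjective : ∀ {K r L} → (Fin L → Fin r → Fin K) → Set
BlocksInjective pos = ∀ ℓ s ℓ′ s′ → pos ℓ s ≡ pos ℓ′ s′ → ℓ ≡ ℓ′ × s ≡ s′

∑ᵛ-∏-blocks : ∀ {D} K r L (pos : Fin L → Fin r → Fin K) (g : Vec (Fin D) r → ℕ) →
               BlocksInjective pos →
               D ^ (L * r) * ∑ᵛ K (λ h → ∏ (λ ℓ → g (select (pos ℓ) h))) ≡ ∑ᵛ r g ^ L * D ^ K
∑ᵛ-∏-blocks {D} K r zero    pos g _ = trans (*-identityˡ _) (trans (∑ᵛ-const K 1) (*-comm (D ^ K) 1))
∑ᵛ-∏-blocks {D} K r (suc L) pos g pos-inj = begin
  D ^ (r + L * r) * ∑ᵛ K (λ h → g (select (pos zero) h) * Rest h)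
    ≡⟨ cong (_* ∑ᵛ K (λ h → g (select (pos zero) h) * Rest h)) (^-distribˡ-+-* D r (L * r)) ⟩
  D ^ r * D ^ (L * r) * ∑ᵛ K (λ h → g (select (pos zero) h) * Rest h)
    ≡⟨ xy∙z≈y∙xz (D ^ r) (D ^ (L * r)) _ ⟩
  D ^ (L * r) * (D ^ r * ∑ᵛ K (λ h → g (select (pos zero) h) * Rest h))
    ≡⟨ cong (D ^ (L * r) *_) (∑ᵛ-factor K r (pos zero) first-injective g Rest Rest-ignores-first) ⟩
  D ^ (L * r) * (∑ᵛ r g * ∑ᵛ K Rest)
    ≡⟨ x∙yz≈y∙xz (D ^ (L * r)) (∑ᵛ r g) _ ⟩
  ∑ᵛ r g * (D ^ (L * r) * ∑ᵛ K Rest)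
    ≡⟨ cong (∑ᵛ r g *_) (∑ᵛ-∏-blocks K r L (pos ∘ suc) g rest-injective) ⟩
  ∑ᵛ r g * (∑ᵛ r g ^ L * D ^ K)
    ≡⟨ *-assoc (∑ᵛ r g) _ _ ⟨
  ∑ᵛ r g * ∑ᵛ r g ^ L * D ^ K
    ∎
  where
  open ≡-Reasoning
  Rest : Vec (Fin D) K → ℕ
  Rest h = ∏ (λ ℓ → g (select (pos (suc ℓ)) h))
  first-injective : Injective _≡_ _≡_ (pos zero)
  first-injective e = proj₂ (pos-inj _ _ _ _ e)
  rest-injective : BlocksInjective (pos ∘ suc)
  rest-injective ℓ s ℓ′ s′ e with pos-inj _ _ _ _ e
  ... | refl , s≡s′ = refl , s≡s′
  Rest-ignores-first : ∀ v h → Rest (overwrite (pos zero) v h) ≡ Rest h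
  Rest-ignores-first v h = ∏-cong (λ ℓ → cong g (select-overwrite-outside (pos (suc ℓ)) (pos zero)
    (λ s′ s e → Fin.0≢1+n (sym (proj₁ (pos-inj _ _ _ _ e)))) v h))

-- Opaque, so that the type checker never runs this decision procedure while comparing counts.
opaque
  blocksInjective? : ∀ {K r L} (pos : Fin L → Fin r → Fin K) → Dec (BlocksInjective pos)
  blocksInjective? pos =
    Fin.all? λ ℓ → Fin.all? λ s → Fin.all? λ ℓ′ → Fin.all? λ s′ →
      (pos ℓ s Fin.≟ pos ℓ′ s′) →-dec ((ℓ Fin.≟ ℓ′) ×-dec (s Fin.≟ s′))

avoid : ∀ {D r} → Vec (Fin D) r → Vec (Fin D) r → ℕ
avoid pat v with ≡-dec Fin._≟_ v pat
... | yes _ = 0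
... | no  _ = 1

avoid-≢ : ∀ {D r} (pat v : Vec (Fin D) r) → v ≢ pat → avoid pat v ≡ 1
avoid-≢ pat v v≢pat with ≡-dec Fin._≟_ v pat
... | yes v≡pat = contradiction v≡pat v≢pat
... | no  _     = refl

module _ {D K r L} (pos : Fin L → Fin r → Fin K) (pat : Vec (Fin D) r) where

  -- Indicator of the h in which no block shows pat, set to 0 when the blocks are not disjoint
  -- so that its sum is bounded unconditionally.
  patternFree : Dec (BlocksInjective pos) → Vec (Fin D) K → ℕ
  patternFree (yes _) h = ∏ (λ ℓ → avoid pat (select (pos ℓ) h))
  patternFree (no  _) h = 0

  ∑ᵛ-patternFree : ∀ d → D ^ (L * r) * ∑ᵛ K (patternFree d) ≤ ∑ᵛ r (avoid pat) ^ L * D ^ K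
  ∑ᵛ-patternFree (yes pos-inj) = ≤-reflexive (∑ᵛ-∏-blocks K r L pos (avoid pat) pos-inj)
  ∑ᵛ-patternFree (no  _)       = begin
    D ^ (L * r) * ∑ᵛ K (λ _ → 0)  ≡⟨ cong (D ^ (L * r) *_) (trans (∑ᵛ-const K 0) (*-zeroʳ (D ^ K))) ⟩
    D ^ (L * r) * 0               ≡⟨ *-zeroʳ (D ^ (L * r)) ⟩
    0                             ≤⟨ z≤n ⟩
    ∑ᵛ r (avoid pat) ^ L * D ^ K  ∎
    where open ≤-Reasoning

  patternFree≡1 : BlocksInjective pos → ∀ h → (∀ ℓ → select (pos ℓ) h ≢ pat) → ∀ d → patternFree d h ≡ 1
  patternFree≡1 pos-inj h no-pattern (yes _)   = ∏-ones _ (λ ℓ → avoid-≢ pat _ (no-pattern ℓ))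
  patternFree≡1 pos-inj h no-pattern (no ¬inj)  = contradiction pos-inj ¬inj

patternFree-cong : ∀ {D K r L} {pos pos′ : Fin L → Fin r → Fin K} (pat : Vec (Fin D) r) →
                (∀ ℓ s → pos ℓ s ≡ pos′ ℓ s) → ∀ d d′ h → patternFree pos pat d h ≡ patternFree pos′ pat d′ h
patternFree-cong pat pos≗pos′ (yes _)       (yes _)        h =
  ∏-cong (λ ℓ → cong (avoid pat) (tabulate-cong (λ s → cong (lookup h) (pos≗pos′ ℓ s))))
patternFree-cong pat pos≗pos′ (no  _)       (no  _)        h = refl
patternFree-cong pat pos≗pos′ (yes pos-inj) (no  ¬pos′-inj) h = contradiction
  (λ ℓ s ℓ′ s′ e → pos-inj ℓ s ℓ′ s′ (trans (pos≗pos′ ℓ s) (trans e (sym (pos≗pos′ ℓ′ s′))))) ¬pos′-inj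
patternFree-cong pat pos≗pos′ (no  ¬pos-inj) (yes pos′-inj) h = contradiction
  (λ ℓ s ℓ′ s′ e → pos′-inj ℓ s ℓ′ s′ (trans (sym (pos≗pos′ ℓ s)) (trans e (pos≗pos′ ℓ′ s′)))) ¬pos-inj

pairIndex : ∀ {M} → Fin M → Fin M → Fin (M * M)
pairIndex x y with x Fin.≤? y
... | yes _ = combine x y
... | no  _ = combine y x

pairIndex-comm : ∀ {M} (x y : Fin M) → pairIndex x y ≡ pairIndex y x
pairIndex-comm x y with x Fin.≤? y | y Fin.≤? x
... | yes x≤y | yes y≤x rewrite Fin.≤-antisym x≤y y≤x = refl
... | yes _   | no  _   = refl
... | no  _   | yes _   = refl
... | no  x≰y | no  y≰x = contradiction (≰⇒≥ y≰x) x≰y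

pairIndex-injective : ∀ {M} (x y x′ y′ : Fin M) → pairIndex x y ≡ pairIndex x′ y′ →
                      (x ≡ x′ × y ≡ y′) ⊎ (x ≡ y′ × y ≡ x′)
pairIndex-injective x y x′ y′ e with x Fin.≤? y | x′ Fin.≤? y′
... | yes _ | yes _ = inj₁ (Fin.combine-injective x y x′ y′ e)
... | yes _ | no  _ = inj₂ (Fin.combine-injective x y y′ x′ e)
... | no  _ | yes _ = let y≡x′ , x≡y′ = Fin.combine-injective y x x′ y′ e in inj₂ (x≡y′ , y≡x′)
... | no  _ | no  _ = let y≡y′ , x≡x′ = Fin.combine-injective y x y′ x′ e in inj₁ (x≡x′ , y≡y′)

-- Colourings of the pairs of Fin M are encoded by vectors indexed by pairIndex, with 0 for red.
color : Fin 2 → Color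
color zero    = red
color (suc _) = blue

coloringOf : ∀ {M} → Vec (Fin 2) (M * M) → Coloring M
coloringOf h = (λ x y → color (lookup h (pairIndex x y)))
             , (λ x y → cong (color ∘ lookup h) (pairIndex-comm x y))

module Grid (m : ℕ) where

  row col : Fin (m * m) → Fin m
  row ℓ = remQuot {m} m ℓ .proj₁
  col ℓ = remQuot {m} m ℓ .proj₂

  row-col-injective : ∀ {ℓ ℓ′} → row ℓ ≡ row ℓ′ → col ℓ ≡ col ℓ′ → ℓ ≡ ℓ′
  row-col-injective {ℓ} {ℓ′} i≡i′ j≡j′ = begin
    ℓ                         ≡⟨ Fin.combine-remQuot {m} m ℓ ⟨
    combine (row ℓ) (col ℓ)   ≡⟨ cong₂ combine i≡i′ j≡j′ ⟩
    combine (row ℓ′) (col ℓ′) ≡⟨ Fin.combine-remQuot {m} m ℓ′ ⟩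
    ℓ′                        ∎
    where open ≡-Reasoning

module Triples {M n : ℕ} (a b c : Fin n → Fin M) where
  open Grid n

  positions : Fin (n * n) → Fin 2 → Fin (M * M)
  positions ℓ zero       = pairIndex (a (row ℓ)) (b (col ℓ))
  positions ℓ (suc zero) = pairIndex (a (row ℓ)) (c (col ℓ))

  positions-injective : Injective _≡_ _≡_ a → Injective _≡_ _≡_ b → Injective _≡_ _≡_ c →
                        (∀ i j → a i ≢ b j) → (∀ i j → a i ≢ c j) → (∀ i j → b i ≢ c j) →
                        BlocksInjective positions
  positions-injective a-inj b-inj c-inj a∉b a∉c b∉c = injective
    where
    injective : BlocksInjective positions
    injective ℓ zero ℓ′ zero e
      with pairIndex-injective (a (row ℓ)) (b (col ℓ)) (a (row ℓ′)) (b (col ℓ′)) e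
    ... | inj₁ (ai≡ai′ , bj≡bj′) = row-col-injective (a-inj ai≡ai′) (b-inj bj≡bj′) , refl
    ... | inj₂ (ai≡bj′ , _)      = contradiction ai≡bj′ (a∉b _ _)
    injective ℓ zero ℓ′ (suc zero) e
      with pairIndex-injective (a (row ℓ)) (b (col ℓ)) (a (row ℓ′)) (c (col ℓ′)) e
    ... | inj₁ (_ , bj≡cj′)      = contradiction bj≡cj′ (b∉c _ _)
    ... | inj₂ (ai≡cj′ , _)      = contradiction ai≡cj′ (a∉c _ _)
    injective ℓ (suc zero) ℓ′ zero e
      with pairIndex-injective (a (row ℓ)) (c (col ℓ)) (a (row ℓ′)) (b (col ℓ′)) e
    ... | inj₁ (_ , cj≡bj′)      = contradiction (sym cj≡bj′) (b∉c _ _)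
    ... | inj₂ (ai≡bj′ , _)      = contradiction ai≡bj′ (a∉b _ _)
    injective ℓ (suc zero) ℓ′ (suc zero) e
      with pairIndex-injective (a (row ℓ)) (c (col ℓ)) (a (row ℓ′)) (c (col ℓ′)) e
    ... | inj₁ (ai≡ai′ , cj≡cj′) = row-col-injective (a-inj ai≡ai′) (c-inj cj≡cj′) , refl
    ... | inj₂ (ai≡cj′ , _)      = contradiction ai≡cj′ (a∉c _ _)

  forbidden : Vec (Fin 2) 2
  forbidden = 1F ∷ 0F ∷ []

  no-forbidden-block : ∀ h → (∀ i j → (proj₁ (coloringOf h) (a i) (b j) ≡ red)
                                    ⊎ (proj₁ (coloringOf h) (a i) (c j) ≡ blue)) →
                       ∀ ℓ → select (positions ℓ) h ≢ forbidden
  no-forbidden-block h red-or-blue ℓ e =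
    [ (λ ab-red  → contradiction (trans (sym ab-red)  (edge-color 0F)) λ ())
    , (λ ac-blue → contradiction (trans (sym ac-blue) (edge-color 1F)) λ ())
    ] (red-or-blue (row ℓ) (col ℓ))
    where
    edge-color : ∀ s → color (lookup h (positions ℓ s)) ≡ color (lookup forbidden s)
    edge-color s = cong color (lookup-select (positions ℓ) h e s)

  count : Vec (Fin 2) (M * M) → ℕ
  count = patternFree positions forbidden (blocksInjective? positions)

  count-bound : 2 ^ (n * n * 2) * ∑ᵛ (M * M) count ≤ 3 ^ (n * n) * 2 ^ (M * M)
  count-bound = ∑ᵛ-patternFree positions forbidden (blocksInjective? positions)

  count≡1 : Injective _≡_ _≡_ a → Injective _≡_ _≡_ b → Injective _≡_ _≡_ c →
            (∀ i j → a i ≢ b j) → (∀ i j → a i ≢ c j) → (∀ i j → b i ≢ c j) →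
            ∀ h → (∀ i j → (proj₁ (coloringOf h) (a i) (b j) ≡ red)
                         ⊎ (proj₁ (coloringOf h) (a i) (c j) ≡ blue)) → count h ≡ 1
  count≡1 a-inj b-inj c-inj a∉b a∉c b∉c h red-or-blue =
    patternFree≡1 positions forbidden (positions-injective a-inj b-inj c-inj a∉b a∉c b∉c)
               h (no-forbidden-block h red-or-blue) (blocksInjective? positions)

triples-count-cong : ∀ {M n} {a b c a′ b′ c′ : Fin n → Fin M} → a ≗ a′ → b ≗ b′ → c ≗ c′ →
                     Triples.count a b c ≗ Triples.count a′ b′ c′
triples-count-cong {a = a} {b} {c} {a′} {b′} {c′} a≗a′ b≗b′ c≗c′ =
  patternFree-cong (Triples.forbidden a b c) same-positions
                (blocksInjective? (Triples.positions a b c)) (blocksInjective? (Triples.positions a′ b′ c′))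
  where
  same-positions : ∀ ℓ s → Triples.positions a b c ℓ s ≡ Triples.positions a′ b′ c′ ℓ s
  same-positions ℓ zero       = cong₂ pairIndex (a≗a′ _) (b≗b′ _)
  same-positions ℓ (suc zero) = cong₂ pairIndex (a≗a′ _) (c≗c′ _)

StrictlyIncreasing : ∀ {m n} → (Fin m → Fin n) → Set
StrictlyIncreasing a = ∀ i j → i <ᶠ j → a i <ᶠ a j

strictlyIncreasing⇒injective : ∀ {m n} {a : Fin m → Fin n} → StrictlyIncreasing a → Injective _≡_ _≡_ a
strictlyIncreasing⇒injective {a = a} a-incr {i} {j} ai≡aj with Fin.<-cmp i j
... | tri< i<j _ _ = contradiction ai≡aj (Fin.<⇒≢ (a-incr i j i<j))
... | tri≈ _ i≡j _ = i≡j
... | tri> _ _ j<i = contradiction (sym ai≡aj) (Fin.<⇒≢ (a-incr j i j<i))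

record Packing (n L : ℕ) : Set where
  field
    point      : Fin L → Fin 4 → Fin n
    increasing : ∀ ℓ → StrictlyIncreasing (point ℓ)
    meet-once  : ∀ {ℓ ℓ′ t₁ t₂ t₁′ t₂′} → t₁ <ᶠ t₂ →
                 point ℓ t₁ ≡ point ℓ′ t₁′ → point ℓ t₂ ≡ point ℓ′ t₂′ → ℓ ≡ ℓ′ × t₁ ≡ t₁′ × t₂ ≡ t₂′

-- The six pairs of a 4-tuple x < y < z < w, in the order xy, yz, yw, xz, xw, zw used by Pattern.
edge : Fin 6 → Fin 4 × Fin 4
edge 0F = 0F , 1F
edge 1F = 1F , 2F
edge 2F = 1F , 3F
edge 3F = 0F , 2F
edge 4F = 0F , 3F
edge 5F = 2F , 3F

edge-increasing : ∀ s → proj₁ (edge s) <ᶠ proj₂ (edge s)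
edge-increasing = toWitness {a? = Fin.all? λ s → proj₁ (edge s) Fin.<? proj₂ (edge s)} _

edge-injective : ∀ s s′ → edge s ≡ edge s′ → s ≡ s′
edge-injective = toWitness {a? = Fin.all? λ s → Fin.all? λ s′ →
                             Product.≡-dec Fin._≟_ Fin._≟_ (edge s) (edge s′) →-dec (s Fin.≟ s′)} _

module Sets {M n L : ℕ} (P : Packing n L) (a : Fin n → Fin M) where
  open Packing P

  ends : Fin L → Fin 6 → Fin n × Fin n
  ends ℓ s = point ℓ (proj₁ (edge s)) , point ℓ (proj₂ (edge s))

  positions : Fin L → Fin 6 → Fin (M * M)
  positions ℓ s = pairIndex (a (proj₁ (ends ℓ s))) (a (proj₂ (ends ℓ s)))

  positions-injective : StrictlyIncreasing a → BlocksInjective positions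
  positions-injective a-incr = injective
    where
    a-inj = strictlyIncreasing⇒injective a-incr
    injective : BlocksInjective positions
    injective ℓ s ℓ′ s′ e
      with pairIndex-injective (a (proj₁ (ends ℓ s))) (a (proj₂ (ends ℓ s)))
                               (a (proj₁ (ends ℓ′ s′))) (a (proj₂ (ends ℓ′ s′))) e
    ... | inj₁ (ax≡ax′ , ay≡ay′) =
      let ℓ≡ℓ′ , t₁≡t₁′ , t₂≡t₂′ = meet-once (edge-increasing s) (a-inj ax≡ax′) (a-inj ay≡ay′)
      in ℓ≡ℓ′ , edge-injective s s′ (cong₂ _,_ t₁≡t₁′ t₂≡t₂′)
    ... | inj₂ (ax≡ay′ , ay≡ax′) = contradiction
      (subst₂ _<ᶠ_ (sym (a-inj ay≡ax′)) (sym (a-inj ax≡ay′)) (increasing ℓ′ _ _ (edge-increasing s′)))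
      (Fin.<-asym (increasing ℓ _ _ (edge-increasing s)))

  forbidden : Vec (Fin 2) 6
  forbidden = 0F ∷ 0F ∷ 0F ∷ 1F ∷ 1F ∷ 1F ∷ []

  no-forbidden-block : ∀ h → (∀ i j k l → i <ᶠ j → j <ᶠ k → k <ᶠ l →
                               ¬ Pattern (proj₁ (coloringOf h)) (a i) (a j) (a k) (a l)) →
                       ∀ ℓ → select (positions ℓ) h ≢ forbidden
  no-forbidden-block h avoids ℓ e =
    avoids _ _ _ _
      (increasing ℓ 0F 1F z<s) (increasing ℓ 1F 2F (s<s z<s)) (increasing ℓ 2F 3F (s<s (s<s z<s)))
      (edge-color 0F , edge-color 1F , edge-color 2F , edge-color 3F , edge-color 4F , edge-color 5F)
    where
    edge-color : ∀ s → color (lookup h (positions ℓ s)) ≡ color (lookup forbidden s)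
    edge-color s = cong color (lookup-select (positions ℓ) h e s)

  count : Vec (Fin 2) (M * M) → ℕ
  count = patternFree positions forbidden (blocksInjective? positions)

  count-bound : 2 ^ (L * 6) * ∑ᵛ (M * M) count ≤ 63 ^ L * 2 ^ (M * M)
  count-bound = ∑ᵛ-patternFree positions forbidden (blocksInjective? positions)

  count≡1 : StrictlyIncreasing a → ∀ h →
            (∀ i j k l → i <ᶠ j → j <ᶠ k → k <ᶠ l →
                         ¬ Pattern (proj₁ (coloringOf h)) (a i) (a j) (a k) (a l)) →
            count h ≡ 1
  count≡1 a-incr h avoids =
    patternFree≡1 positions forbidden (positions-injective a-incr) h (no-forbidden-block h avoids)
               (blocksInjective? positions)

sets-count-cong : ∀ {M n L} (P : Packing n L) {a a′ : Fin n → Fin M} → a ≗ a′ →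
                  Sets.count P a ≗ Sets.count P a′
sets-count-cong P {a} {a′} a≗a′ =
  patternFree-cong (Sets.forbidden P a) (λ ℓ s → cong₂ pairIndex (a≗a′ _) (a≗a′ _))
                (blocksInjective? (Sets.positions P a)) (blocksInjective? (Sets.positions P a′))

affine-injective : ∀ {u v i j i′ j′} → u < v → i + u * j ≡ i′ + u * j′ → i + v * j ≡ i′ + v * j′ →
                   i ≡ i′ × j ≡ j′
affine-injective {u} {v} {i} {j} {i′} {j′} u<v e₁ e₂ with m≤n⇒∃[o]m+o≡n u<v
... | d , refl = i≡i′ , j≡j′
  where
  expand : ∀ u d i j → i + (1 + u + d) * j ≡ (i + u * j) + (1 + d) * j
  expand = solve-∀
  j≡j′ : j ≡ j′
  j≡j′ = *-cancelˡ-≡ j j′ (1 + d) (+-cancelˡ-≡ (i + u * j) _ _ (begin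
    (i + u * j) + (1 + d) * j     ≡⟨ expand u d i j ⟨
    i + (1 + u + d) * j           ≡⟨ e₂ ⟩
    i′ + (1 + u + d) * j′         ≡⟨ expand u d i′ j′ ⟩
    (i′ + u * j′) + (1 + d) * j′  ≡⟨ cong (_+ (1 + d) * j′) e₁ ⟨
    (i + u * j) + (1 + d) * j′    ∎))
    where open ≡-Reasoning
  i≡i′ : i ≡ i′
  i≡i′ = +-cancelʳ-≡ (u * j) i i′ (trans e₁ (cong (λ j → i′ + u * j) (sym j≡j′)))

-- Block (i , j) has its t-th point at height i + t * j on the t-th of four lines of length 4 * m,
-- so two blocks sharing two points have the same (i , j) by affine-injective.
module LinePacking (m : ℕ) where
  open Grid m

  height : Fin (m * m) → Fin 4 → ℕ
  height ℓ t = toℕ (row ℓ) + toℕ t * toℕ (col ℓ)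

  height< : ∀ ℓ t → height ℓ t < 4 * m
  height< ℓ t =
    +-mono-<-≤ (Fin.toℕ<n (row ℓ)) (*-mono-≤ (Fin.toℕ≤pred[n] t) (<⇒≤ (Fin.toℕ<n (col ℓ))))

  point : Fin (m * m) → Fin 4 → Fin (4 * (4 * m))
  point ℓ t = combine t (fromℕ< (height< ℓ t))

  same-point : ∀ {ℓ ℓ′ t t′} → point ℓ t ≡ point ℓ′ t′ → t ≡ t′ × height ℓ t ≡ height ℓ′ t′
  same-point {ℓ} {ℓ′} {t} {t′} e with Fin.combine-injective t _ t′ _ e
  ... | t≡t′ , offset≡ =
    t≡t′ , trans (sym (Fin.toℕ-fromℕ< (height< ℓ t)))
                 (trans (cong toℕ offset≡) (Fin.toℕ-fromℕ< (height< ℓ′ t′)))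

  linePacking : Packing (4 * (4 * m)) (m * m)
  linePacking = record
    { point      = point
    ; increasing = λ ℓ t t′ → Fin.combine-monoˡ-< _ _
    ; meet-once  = meet-once
    }
    where
    meet-once : ∀ {ℓ ℓ′ t₁ t₂ t₁′ t₂′} → t₁ <ᶠ t₂ →
                point ℓ t₁ ≡ point ℓ′ t₁′ → point ℓ t₂ ≡ point ℓ′ t₂′ → ℓ ≡ ℓ′ × t₁ ≡ t₁′ × t₂ ≡ t₂′
    meet-once {ℓ} {ℓ′} {t₁} {t₂} {t₁′} {t₂′} t₁<t₂ e₁ e₂
      with same-point {ℓ} {ℓ′} {t₁} {t₁′} e₁ | same-point {ℓ} {ℓ′} {t₂} {t₂′} e₂
    ... | refl , h₁ | refl , h₂ =
      let i≡i′ , j≡j′ = affine-injective t₁<t₂ h₁ h₂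
      in row-col-injective (Fin.toℕ-injective i≡i′) (Fin.toℕ-injective j≡j′) , refl , refl

inject≤-packing : ∀ {n n′ L} → n ≤ n′ → Packing n L → Packing n′ L
inject≤-packing n≤n′ P = record
  { point      = λ ℓ t → inject≤ (point ℓ t) n≤n′
  ; increasing = λ ℓ t t′ t<t′ →
      subst₂ _<_ (sym (Fin.toℕ-inject≤ _ n≤n′)) (sym (Fin.toℕ-inject≤ _ n≤n′)) (increasing ℓ t t′ t<t′)
  ; meet-once  = λ t₁<t₂ e₁ e₂ →
      meet-once t₁<t₂ (Fin.inject≤-injective n≤n′ n≤n′ _ _ e₁) (Fin.inject≤-injective n≤n′ n≤n′ _ _ e₂)
  }
  where open Packing P

^-distribʳ-* : ∀ m n o → (m * n) ^ o ≡ m ^ o * n ^ o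
^-distribʳ-* m n zero    = refl
^-distribʳ-* m n (suc o) = begin
  m * n * (m * n) ^ o     ≡⟨ cong (m * n *_) (^-distribʳ-* m n o) ⟩
  m * n * (m ^ o * n ^ o) ≡⟨ medial m n (m ^ o) (n ^ o) ⟩
  m * m ^ o * (n * n ^ o) ∎
  where
  open ≡-Reasoning
  medial : ∀ a b c d → a * b * (c * d) ≡ a * c * (b * d)
  medial = solve-∀

^-distribˡ-+-+-* : ∀ x n y → x ^ (n + (n + n)) * y ≡ x ^ n * (x ^ n * (x ^ n * y))
^-distribˡ-+-+-* x n y = begin
  x ^ (n + (n + n)) * y          ≡⟨ cong (_* y) (^-distribˡ-+-* x n (n + n)) ⟩
  x ^ n * x ^ (n + n) * y        ≡⟨ cong (λ z → x ^ n * z * y) (^-distribˡ-+-* x n n) ⟩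
  x ^ n * (x ^ n * x ^ n) * y    ≡⟨ reassoc (x ^ n) y ⟩
  x ^ n * (x ^ n * (x ^ n * y))  ∎
  where
  open ≡-Reasoning
  reassoc : ∀ a y → a * (a * a) * y ≡ a * (a * (a * y))
  reassoc = solve-∀

^-cancelˡ-< : ∀ {x y} q → x ^ q < y ^ q → x < y
^-cancelˡ-< {x} {y} q xq<yq = ≰⇒> (λ y≤x → <⇒≱ xq<yq (^-monoˡ-≤ q y≤x))

-- Proved after raising both sides to the q-th power; b ^ k * 2 ^ j ≤ 2 ^ l says log₂ b ≤ (l - j) / k.
2*M^a*b^c<2^d : ∀ {M q s b k j l a c d t} .{{_ : NonZero b}} →
                M ^ q ≤ 2 ^ s → b ^ k * 2 ^ j ≤ 2 ^ l →
                c * q ≡ k * t → d * q ≡ l * t → q + s * a < j * t →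
                2 * (M ^ a * b ^ c) < 2 ^ d
2*M^a*b^c<2^d {M} {q} {s} {b} {k} {j} {l} {a} {c} {d} {t} Mq≤2s bk2j≤2l cq≡kt dq≡lt exponents =
  ^-cancelˡ-< q (begin-strict
    (2 * (M ^ a * b ^ c)) ^ q           ≡⟨ ^-distribʳ-* 2 _ q ⟩
    2 ^ q * (M ^ a * b ^ c) ^ q         ≡⟨ cong (2 ^ q *_) (^-distribʳ-* (M ^ a) (b ^ c) q) ⟩
    2 ^ q * ((M ^ a) ^ q * (b ^ c) ^ q) ≡⟨ cong (λ x → 2 ^ q * (x * (b ^ c) ^ q)) (^-swap M a q) ⟩
    2 ^ q * ((M ^ q) ^ a * (b ^ c) ^ q) ≤⟨ *-monoʳ-≤ (2 ^ q) (*-monoˡ-≤ ((b ^ c) ^ q) (^-monoˡ-≤ a Mq≤2s)) ⟩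
    2 ^ q * ((2 ^ s) ^ a * (b ^ c) ^ q) ≡⟨ *-assoc (2 ^ q) _ _ ⟨
    2 ^ q * (2 ^ s) ^ a * (b ^ c) ^ q   ≡⟨ cong (λ x → 2 ^ q * x * (b ^ c) ^ q) (^-*-assoc 2 s a) ⟩
    2 ^ q * 2 ^ (s * a) * (b ^ c) ^ q   ≡⟨ cong (_* (b ^ c) ^ q) (^-distribˡ-+-* 2 q (s * a)) ⟨
    2 ^ (q + s * a) * (b ^ c) ^ q       <⟨ *-monoˡ-< ((b ^ c) ^ q) {{m^n≢0 (b ^ c) q {{m^n≢0 b c}}}}
                                             (^-monoʳ-< 2 (s≤s (s≤s z≤n)) exponents) ⟩
    2 ^ (j * t) * (b ^ c) ^ q           ≡⟨ cong (2 ^ (j * t) *_) bcq≡bkt ⟩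
    2 ^ (j * t) * (b ^ k) ^ t           ≡⟨ cong (_* (b ^ k) ^ t) (^-*-assoc 2 j t) ⟨
    (2 ^ j) ^ t * (b ^ k) ^ t           ≡⟨ ^-distribʳ-* (2 ^ j) (b ^ k) t ⟨
    (2 ^ j * b ^ k) ^ t                 ≡⟨ cong (_^ t) (*-comm (2 ^ j) (b ^ k)) ⟩
    (b ^ k * 2 ^ j) ^ t                 ≤⟨ ^-monoˡ-≤ t bk2j≤2l ⟩
    (2 ^ l) ^ t                         ≡⟨ ^-*-assoc 2 l t ⟩
    2 ^ (l * t)                         ≡⟨ cong (2 ^_) dq≡lt ⟨
    2 ^ (d * q)                         ≡⟨ ^-*-assoc 2 d q ⟨
    (2 ^ d) ^ q                         ∎)
  where
  open ≤-Reasoning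
  ^-swap : ∀ x m n → (x ^ m) ^ n ≡ (x ^ n) ^ m
  ^-swap x m n = trans (^-*-assoc x m n) (trans (cong (x ^_) (*-comm m n)) (sym (^-*-assoc x n m)))
  bcq≡bkt : (b ^ c) ^ q ≡ (b ^ k) ^ t
  bcq≡bkt = trans (^-*-assoc b c q) (trans (cong (b ^_) cq≡kt) (sym (^-*-assoc b k t)))

-- Opaque, so that the type checker never attempts to evaluate 2 ^ q.
opaque
  q : ℕ
  q = 110000

opaque
  unfolding q

  q≡110000 : q ≡ 110000
  q≡110000 = refl

rescale : ∀ c a b r → c * a * (b * r) ≡ a * b * (r * c)
rescale = solve-∀

module Arithmetic (n N : ℕ) (6≤n : 6 ≤ n) (n≤1+N : n ≤ suc N) (Nq≤2n : N ^ q ≤ 2 ^ n) where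

  2≤N : 2 ≤ N
  2≤N = ≤-pred (≤-trans (s≤s (s≤s (s≤s z≤n))) (≤-trans 6≤n n≤1+N))

  q≤n : q ≤ n
  q≤n = ≮⇒≥ (λ n<q → <⇒≱ (^-monoʳ-< 2 (s≤s (s≤s z≤n)) n<q) (≤-trans (^-monoˡ-≤ q 2≤N) Nq≤2n))

  [1+N]^q≤2^[n+n] : suc N ^ q ≤ 2 ^ (n + n)
  [1+N]^q≤2^[n+n] = begin
    suc N ^ q      ≤⟨ ^-monoˡ-≤ q (+-monoˡ-≤ N (≤-trans (s≤s z≤n) 2≤N)) ⟩
    (N + N) ^ q    ≡⟨ cong (_^ q) (cong (N +_) (+-identityʳ N)) ⟨
    (2 * N) ^ q    ≡⟨ ^-distribʳ-* 2 N q ⟩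
    2 ^ q * N ^ q  ≤⟨ *-mono-≤ (^-monoʳ-≤ 2 q≤n) Nq≤2n ⟩
    2 ^ n * 2 ^ n  ≡⟨ ^-distribˡ-+-* 2 n n ⟨
    2 ^ (n + n)    ∎
    where open ≤-Reasoning

  instance
    n≢0 : NonZero n
    n≢0 = >-nonZero (≤-trans (s≤s z≤n) 6≤n)

  n≤n*n : n ≤ n * n
  n≤n*n = m≤m*n n n

  triple-bound : 2 * (suc N ^ n * (suc N ^ n * (suc N ^ n * 3 ^ (n * n)))) < 2 ^ (n * n * 2)
  triple-bound = subst (λ x → 2 * x < 2 ^ (n * n * 2)) (^-distribˡ-+-+-* (suc N) n (3 ^ (n * n))) $
    2*M^a*b^c<2^d {M = suc N} {q = q} {s = n + n} {b = 3} {k = 5} {j = 2} {l = 10}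
                  {a = n + (n + n)} {c = n * n} {d = n * n * 2} {t = 22000 * (n * n)}
    [1+N]^q≤2^[n+n] (≤ᵇ⇒≤ (3 ^ 5 * 2 ^ 2) (2 ^ 10) _)
    (trans (cong (n * n *_) q≡110000) (x∙yz≈y∙zx (n * n) 5 22000))
    (trans (cong (n * n * 2 *_) q≡110000) (rescale (n * n) 2 5 22000)) (begin-strict
      q + (n + n) * (n + (n + n))      ≤⟨ +-monoˡ-≤ _ (≤-trans q≤n n≤n*n) ⟩
      n * n + (n + n) * (n + (n + n))  ≡⟨ sevenfold n ⟩
      7 * (n * n)                      <⟨ *-monoˡ-< (n * n) {{m*n≢0 n n}} (≤ᵇ⇒≤ 8 44000 _) ⟩
      44000 * (n * n)                  ≡⟨ *-assoc 2 22000 (n * n) ⟩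
      2 * (22000 * (n * n))            ∎)
    where
    open ≤-Reasoning
    sevenfold : ∀ n → n * n + (n + n) * (n + (n + n)) ≡ 7 * (n * n)
    sevenfold = solve-∀

  m : ℕ
  m = n / 16

  16m≤n : 4 * (4 * m) ≤ n
  16m≤n = subst (_≤ n) (sixteenfold m) (m/n*n≤m n 16)
    where
    sixteenfold : ∀ m → m * 16 ≡ 4 * (4 * m)
    sixteenfold = solve-∀

  5≤m : 5 ≤ m
  5≤m = /-monoˡ-≤ 16 (≤-trans (subst (80 ≤_) (sym q≡110000) (≤ᵇ⇒≤ 80 110000 _)) q≤n)

  n≤19m : n ≤ 19 * m
  n≤19m = begin
    n                 ≡⟨ m≡m%n+[m/n]*n n 16 ⟩
    n % 16 + m * 16   ≤⟨ +-monoˡ-≤ (m * 16) (≤-pred (m%n<n n 16)) ⟩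
    15 + m * 16       ≤⟨ +-monoˡ-≤ (m * 16) (*-monoʳ-≤ 3 5≤m) ⟩
    3 * m + m * 16    ≡⟨ nineteenfold m ⟩
    19 * m            ∎
    where
    open ≤-Reasoning
    nineteenfold : ∀ m → 3 * m + m * 16 ≡ 19 * m
    nineteenfold = solve-∀

  set-bound : 2 * (suc N ^ n * 63 ^ (m * m)) < 2 ^ (m * m * 6)
  set-bound =
    2*M^a*b^c<2^d {M = suc N} {q = q} {s = n + n} {b = 63} {k = 88} {j = 1} {l = 528}
                  {a = n} {c = m * m} {d = m * m * 6} {t = 1250 * (m * m)}
    [1+N]^q≤2^[n+n] (≤ᵇ⇒≤ (63 ^ 88 * 2 ^ 1) (2 ^ 528) _)
    (trans (cong (m * m *_) q≡110000) (x∙yz≈y∙zx (m * m) 88 1250))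
    (trans (cong (m * m * 6 *_) q≡110000) (rescale (m * m) 6 88 1250))
    (begin-strict
      q + (n + n) * n          ≤⟨ +-monoˡ-≤ _ (≤-trans q≤n n≤n*n) ⟩
      n * n + (n + n) * n      ≡⟨ threefold n ⟩
      3 * (n * n)              ≤⟨ *-monoʳ-≤ 3 (*-mono-≤ n≤19m n≤19m) ⟩
      3 * (19 * m * (19 * m))  ≡⟨ square-scale 3 19 m ⟩
      1083 * (m * m)           <⟨ *-monoˡ-< (m * m) {{m*n≢0 m m}} (≤ᵇ⇒≤ 1084 1250 _) ⟩
      1250 * (m * m)           ≡⟨ *-identityˡ (1250 * (m * m)) ⟨
      1 * (1250 * (m * m))     ∎)
    where
    open ≤-Reasoning
    instance
      m≢0 : NonZero m
      m≢0 = >-nonZero (≤-trans (s≤s z≤n) 5≤m)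
    threefold : ∀ n → n * n + (n + n) * n ≡ 3 * (n * n)
    threefold = solve-∀
    square-scale : ∀ a k m → a * (k * m * (k * m)) ≡ a * (k * k) * (m * m)
    square-scale = solve-∀

∑ᵛ-union-bound : ∀ {D D′} n K B Y Z (F : Vec (Fin D) n → Vec (Fin D′) K → ℕ) →
                 (∀ w → B * ∑ᵛ K (F w) ≤ Y * Z) →
                 B * ∑ᵛ K (λ h → ∑ᵛ n (λ w → F w h)) ≤ D ^ n * Y * Z
∑ᵛ-union-bound {D} n K B Y Z F each = begin
  B * ∑ᵛ K (λ h → ∑ᵛ n (λ w → F w h))  ≡⟨ cong (B *_) (∑ᵛ-comm K n (λ h w → F w h)) ⟩
  B * ∑ᵛ n (λ w → ∑ᵛ K (F w))          ≡⟨ *-distribˡ-∑ᵛ n B _ ⟩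
  ∑ᵛ n (λ w → B * ∑ᵛ K (F w))          ≤⟨ ∑ᵛ-mono n each ⟩
  ∑ᵛ n (λ _ → Y * Z)                   ≡⟨ ∑ᵛ-const n (Y * Z) ⟩
  D ^ n * (Y * Z)                      ≡⟨ *-assoc (D ^ n) Y Z ⟨
  D ^ n * Y * Z                        ∎
  where open ≤-Reasoning

twice-<-cancel : ∀ B S Y Z .{{_ : NonZero Z}} → B * S ≤ Y * Z → 2 * Y < B → 2 * S < Z
twice-<-cancel B S Y Z BS≤YZ 2Y<B = *-cancelˡ-< B (2 * S) Z (begin-strict
  B * (2 * S)  ≡⟨ x∙yz≈y∙xz B 2 S ⟩
  2 * (B * S)  ≤⟨ *-monoʳ-≤ 2 BS≤YZ ⟩
  2 * (Y * Z)  ≡⟨ *-assoc 2 Y Z ⟨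
  2 * Y * Z    <⟨ *-monoˡ-< Z 2Y<B ⟩
  B * Z        ∎)
  where open ≤-Reasoning

halves-+-< : ∀ x y z → 2 * x < z → 2 * y < z → x + y < z
halves-+-< x y z 2x<z 2y<z = *-cancelˡ-< 2 (x + y) z (begin-strict
  2 * (x + y)    ≡⟨ *-distribˡ-+ 2 x y ⟩
  2 * x + 2 * y  <⟨ +-mono-< 2x<z 2y<z ⟩
  z + z          ≡⟨ cong (z +_) (+-identityʳ z) ⟨
  2 * z          ∎)
  where open ≤-Reasoning

module Construction (n N : ℕ) (6≤n : 6 ≤ n) (n≤1+N : n ≤ suc N) (Nq≤2n : N ^ q ≤ 2 ^ n) where
  open Arithmetic n N 6≤n n≤1+N Nq≤2n

  M : ℕ
  M = suc N

  instance
    2^M²≢0 : NonZero (2 ^ (M * M))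
    2^M²≢0 = m^n≢0 2 (M * M)

  packing : Packing n (m * m)
  packing = inject≤-packing 16m≤n (LinePacking.linePacking m)

  badTriples badSets : Vec (Fin 2) (M * M) → ℕ
  badTriples h = ∑ᵛ {M} n λ va → ∑ᵛ {M} n λ vb → ∑ᵛ {M} n λ vc →
                   Triples.count (lookup va) (lookup vb) (lookup vc) h
  badSets    h = ∑ᵛ {M} n λ va → Sets.count packing (lookup va) h

  few-bad-triples : 2 * ∑ᵛ (M * M) badTriples < 2 ^ (M * M)
  few-bad-triples =
    twice-<-cancel B (∑ᵛ (M * M) badTriples) (M ^ n * (M ^ n * (M ^ n * 3 ^ (n * n)))) (2 ^ (M * M))
    (∑ᵛ-union-bound n (M * M) B (M ^ n * (M ^ n * 3 ^ (n * n))) (2 ^ (M * M))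
       (λ va h → ∑ᵛ {M} n λ vb → ∑ᵛ {M} n λ vc → Triples.count (lookup va) (lookup vb) (lookup vc) h) λ va →
     ∑ᵛ-union-bound n (M * M) B (M ^ n * 3 ^ (n * n)) (2 ^ (M * M))
       (λ vb h → ∑ᵛ {M} n λ vc → Triples.count (lookup va) (lookup vb) (lookup vc) h) λ vb →
     ∑ᵛ-union-bound n (M * M) B (3 ^ (n * n)) (2 ^ (M * M))
       (λ vc → Triples.count (lookup va) (lookup vb) (lookup vc)) λ vc →
     Triples.count-bound (lookup va) (lookup vb) (lookup vc))
    triple-bound
    where B = 2 ^ (n * n * 2)

  few-bad-sets : 2 * ∑ᵛ (M * M) badSets < 2 ^ (M * M)
  few-bad-sets = twice-<-cancel B (∑ᵛ (M * M) badSets) (M ^ n * 63 ^ (m * m)) (2 ^ (M * M))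
    (∑ᵛ-union-bound n (M * M) B (63 ^ (m * m)) (2 ^ (M * M)) (Sets.count packing ∘ lookup) λ va →
     Sets.count-bound packing (lookup va))
    set-bound
    where B = 2 ^ (m * m * 6)

  good-coloring : ∃ λ h → badTriples h + badSets h ≡ 0
  good-coloring = ∑ᵛ<⇒∃≡0 (M * M) (λ h → badTriples h + badSets h)
    (subst (_< 2 ^ (M * M)) (sym (∑ᵛ-distrib-+ (M * M) badTriples badSets))
           (halves-+-< (∑ᵛ (M * M) badTriples) (∑ᵛ (M * M) badSets) (2 ^ (M * M))
                       few-bad-triples few-bad-sets))

  no-bad-triple : ∀ h → badTriples h ≡ 0 → ¬ BadTriple M n (proj₁ (coloringOf h))
  no-bad-triple h no-triples (a , b , c , a-inj , b-inj , c-inj , a∉b , a∉c , b∉c , red-or-blue) =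
    contradiction (begin
      1
        ≡⟨ Triples.count≡1 a b c a-inj b-inj c-inj a∉b a∉c b∉c h red-or-blue ⟨
      Triples.count a b c h
        ≡⟨ triples-count-cong (sym ∘ lookup∘tabulate a) (sym ∘ lookup∘tabulate b)
                              (sym ∘ lookup∘tabulate c) h ⟩
      Triples.count (lookup (tabulate a)) (lookup (tabulate b)) (lookup (tabulate c)) h
        ≡⟨ ∑ᵛ≡0⇒≡0 n _ (∑ᵛ≡0⇒≡0 n _ (∑ᵛ≡0⇒≡0 n _ no-triples (tabulate a)) (tabulate b)) (tabulate c) ⟩
      0
        ∎) λ ()
    where open ≡-Reasoning

  no-bad-set : ∀ h → badSets h ≡ 0 → ¬ BadSet M n (proj₁ (coloringOf h))
  no-bad-set h no-sets (a , a-incr , avoids) = contradiction (begin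
      1                                           ≡⟨ Sets.count≡1 packing a a-incr h avoids ⟨
      Sets.count packing a h                      ≡⟨ sets-count-cong packing (sym ∘ lookup∘tabulate a) h ⟩
      Sets.count packing (lookup (tabulate a)) h  ≡⟨ ∑ᵛ≡0⇒≡0 n _ no-sets (tabulate a) ⟩
      0                                           ∎) λ ()
    where open ≡-Reasoning

  coloring : Σ (Coloring M) λ φ → ¬ BadTriple M n (proj₁ φ) × ¬ BadSet M n (proj₁ φ)
  coloring = coloringOf h
           , no-bad-triple h (m+n≡0⇒m≡0 (badTriples h) none)
           , no-bad-set h (m+n≡0⇒n≡0 (badTriples h) none)
    where
    h = proj₁ good-coloring
    none = proj₂ good-coloring

too-small-for-bad-structures : ∀ {M n} → M < n → (φ : Fin M → Fin M → Color) →
                               ¬ BadTriple M n φ × ¬ BadSet M n φ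
too-small-for-bad-structures M<n φ = no-triple , no-set
  where
  no-triple : ¬ BadTriple _ _ φ
  no-triple (a , _ , _ , a-inj , _) =
    let i , j , i<j , ai≡aj = Fin.pigeonhole M<n a in Fin.<⇒≢ i<j (a-inj ai≡aj)
  no-set : ¬ BadSet _ _ φ
  no-set (a , a-incr , _) =
    let i , j , i<j , ai≡aj = Fin.pigeonhole M<n a in Fin.<⇒≢ (a-incr i j i<j) ai≡aj

coloring-exists : ∀ n N → 6 ≤ n → N ^ q ≤ 2 ^ n →
                  Σ (Coloring (suc N)) λ φ → ¬ BadTriple (suc N) n (proj₁ φ) × ¬ BadSet (suc N) n (proj₁ φ)
coloring-exists n N 6≤n Nq≤2ⁿ with suc N <? n
... | yes 1+N<n = any-coloring , too-small-for-bad-structures 1+N<n (proj₁ any-coloring)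
  where any-coloring = coloringOf (replicate _ zero)
... | no  1+N≮n = Construction.coloring n N 6≤n (≮⇒≥ 1+N≮n) Nq≤2ⁿ

lemma5 : Σ ℕ λ p → Σ ℕ λ q → (0 < p) × (0 < q) ×
           (∀ n N → 6 ≤ n → IsFloorPow2 p q n N →
             Σ (Coloring (suc N)) λ φ →
               (¬ BadTriple (suc N) n (proj₁ φ)) × (¬ BadSet (suc N) n (proj₁ φ)))
lemma5 = 1 , q , z<s , subst (0 <_) (sym q≡110000) z<s ,
  λ n N 6≤n (Nq≤2^[1*n] , _) →
    coloring-exists n N 6≤n (subst (λ e → N ^ q ≤ 2 ^ e) (*-identityˡ n) Nq≤2^[1*n])
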